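{- Let $n\geq 3$ and $3\leq k\leq 2^{n-1}$. Then $$\kappa^s(Q_n;P_k)\leq\kappa(Q_n;P_k)\leq\begin{cases}\lceil\frac{2n}{k+1}\rceil & \text{if } k\text{ is odd},\\ \lceil\frac{2n}{k}\rceil & \text{if } k \text{ is even}.\end{cases}$$
   Context: $Q_n$ is the $n$-dimensional hypercube: its vertices are the binary strings of length $n$, two vertices being adjacent iff they differ in exactly one position. $P_k$ denotes the path with $k$ vertices. For connected graphs $G,H$: an $H$-structure cut of $G$ is a set $F$ of subgraphs of $G$, each isomorphic to $H$, such that $G-V(F)$ is disconnected or trivial (a single vertex); an $H$-substructure cut is defined the same way except that each member of $F$ is isomorphic to a connected subgraph of $H$. $\kappa(G;H)$ (resp. $\kappa^s(G;H)$) is the minimum cardinality of an $H$-structure cut (resp. $H$-substructure cut) of $G$. -}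

module Defs where

open import Data.Bool using (Bool)
open import Data.Nat using (ℕ; zero; suc; _+_; _*_; _∸_; _≤_; _<_; _/_; _%_)
open import Data.Fin using (Fin; toℕ)
open import Data.Vec using (Vec; lookup)
open import Data.List using (List; length)
open import Data.List.Relation.Unary.Any using (Any)
open import Data.Product using (Σ; ∃; ∃-syntax; _×_)
open import Relation.Binary.PropositionalEquality using (_≡_; _≢_)
open import Relation.Nullary using (¬_)
open import Function.Definitions using (Injective)

Vertex : ℕ → Set
Vertex n = Vec Bool n

Adj : {n : ℕ} → Vertex n → Vertex n → Set
Adj {n} x y = Σ (Fin n) λ i → (lookup x i ≢ lookup y i) × (∀ j → j ≢ i → lookup x j ≡ lookup y j)

record PathIn (n j : ℕ) : Set where
  field
    vert : Fin j → Vertex n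
    inj  : Injective _≡_ _≡_ vert
    adj  : ∀ (i i' : Fin j) → toℕ i' ≡ suc (toℕ i) → Adj (vert i) (vert i')
open PathIn public

-- A subgraph of Q_n isomorphic to a connected subgraph of P_k,
-- i.e. to some P_j with 1 ≤ j ≤ k.
SubPathIn : ℕ → ℕ → Set
SubPathIn n k = Σ ℕ λ j → (1 ≤ j) × (j ≤ k) × PathIn n j

Covered : {n : ℕ} {A : Set} → (A → Σ ℕ λ j → PathIn n j) → List A → Vertex n → Set
Covered {n} view F x = Any (λ P → Σ (Fin (Data.Product.proj₁ (view P))) λ i → vert (Data.Product.proj₂ (view P)) i ≡ x) F

data WalkIn {n : ℕ} (R : Vertex n → Set) : Vertex n → Vertex n → Set where
  here : ∀ {u} → WalkIn R u u
  step : ∀ {u w v} → Adj u w → R w → WalkIn R w v → WalkIn R u v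

Disconnected : {n : ℕ} → (Vertex n → Set) → Set
Disconnected {n} R = Σ (Vertex n) λ u → Σ (Vertex n) λ v → R u × R v × ¬ WalkIn R u v

Trivial : {n : ℕ} → (Vertex n → Set) → Set
Trivial {n} R = Σ (Vertex n) λ x → R x × (∀ y → R y → y ≡ x)

IsCutFamily : {n : ℕ} {A : Set} → (A → Σ ℕ λ j → PathIn n j) → List A → Set
IsCutFamily view F = let R = λ x → ¬ Covered view F x in Disconnected R Data.Sum.⊎ Trivial R
  where import Data.Sum

-- P_k-structure cuts and P_k-substructure cuts of Q_n
-- (a family F is a list; its cardinality is its length).
structView : {n k : ℕ} → PathIn n k → Σ ℕ λ j → PathIn n j
structView {n} {k} P = Data.Product._,_ k P

subView : {n k : ℕ} → SubPathIn n k → Σ ℕ λ j → PathIn n j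
subView (Data.Product._,_ j (Data.Product._,_ _ (Data.Product._,_ _ P))) = Data.Product._,_ j P

IsStructureCut : (n k : ℕ) → List (PathIn n k) → Set
IsStructureCut n k F = IsCutFamily structView F

IsSubstructureCut : (n k : ℕ) → List (SubPathIn n k) → Set
IsSubstructureCut n k F = IsCutFamily subView F

IsKappa : (n k m : ℕ) → Set
IsKappa n k m = (Σ (List (PathIn n k)) λ F → IsStructureCut n k F × length F ≡ m)
              × (∀ F → IsStructureCut n k F → m ≤ length F)

IsKappaS : (n k m : ℕ) → Set
IsKappaS n k m = (Σ (List (SubPathIn n k)) λ F → IsSubstructureCut n k F × length F ≡ m)
               × (∀ F → IsSubstructureCut n k F → m ≤ length F)

-- ⌈ a / (b+1) ⌉
ceilDivSuc : ℕ → ℕ → ℕ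
ceilDivSuc a b = (a + b) / suc b

bound : ℕ → ℕ → ℕ
bound n k with k % 2
... | 1 = ceilDivSuc (2 * n) k
... | _ = ceilDivSuc (2 * n) (k ∸ 1)

{-# OPTIONS --safe #-}
-- If a family F of paths covers every neighbour of a vertex x of Q_n but not x itself, then
-- Q_n − V(F) is either disconnected (x is cut off from any other uncovered vertex) or just {x},
-- so F is a cut.  Take x = 0, whose neighbours are the unit vectors e_i.  In Q_n, n = m + 2, the
-- units all lie at even positions of the "snake": the staircase e_{m+1}, e_{m+1} + e_m, e_m, …,
-- e_1 + e_0, e_0, continued by e_0 + g where g runs through a reflected Gray code of the other
-- coordinates; this path has 2m + 1 + 2^{m+1} ≥ 2^{n-1} ≥ k vertices, none of them 0.  With
-- r = ⌈k/2⌉, the window of k consecutive snake vertices starting at position 2qr (or ending at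
-- the end of the snake, if that comes first) contains the units at the positions 2j with
-- ⌊j/r⌋ = q, so ⌈n/r⌉ windows suffice, and ⌈n/r⌉ is the stated bound.  Finally κ and κ^s are
-- attained minima because path families can be enumerated up to their vertex sets and being a
-- cut is decidable, and κ^s ≤ κ because a P_k-structure cut is a P_k-substructure cut.

module Submission where

open import Defs
open import Data.Bool using (true; false; not)
import Data.Bool.Properties as Bool
open import Data.Empty using (⊥-elim)
open import Data.Fin using (Fin; toℕ; fromℕ<; zero; suc)
import Data.Fin.Properties as Fin
open import Data.List using (List; []; _∷_; length; map; filter; _++_; upTo; cartesianProductWith)
open import Data.List.Membership.DecPropositional using () renaming (_∈?_ to ∈-dec)
open import Data.List.Membership.Propositional using (_∈_; find; lose)
open import Data.List.Membership.Propositional.Properties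
  using (∈-cartesianProductWith⁺; ∈-filter⁺; ∈-filter⁻; ∈-map⁺; ∈-++⁺ˡ; ∈-++⁺ʳ; ∈-upTo⁺)
import Data.List.Properties as List
open import Data.List.Relation.Unary.All as All using (All)
open import Data.List.Relation.Unary.Any as Any using (Any; here; there)
import Data.List.Relation.Unary.Any.Properties as Any
open import Data.Nat using (ℕ; zero; suc; _+_; _*_; _^_; _∸_; _/_; _%_; _⊓_; _≤_; _<_; z≤n; s≤s; _≟_; _<?_)
open import Data.Nat.DivMod using (m*n/n≡m; /-monoˡ-≤; m/n*n≤m; m%n<n; m≡m%n+[m/n]*n; [m+kn]%n≡m%n)
open import Data.Nat.Induction using (<-rec)
open import Data.Nat.Properties
open import Data.Nat.Tactic.RingSolver using (solve-∀)
open import Data.Product using (Σ; ∃; _×_; _,_; proj₁; proj₂)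
open import Data.Sum as Sum using (_⊎_; inj₁; inj₂)
open import Data.Vec using (Vec; []; _∷_; lookup; tabulate; replicate)
import Data.Vec.Properties as Vec
open import Function using (_∘_)
open import Function.Bundles using (_⇔_; mk⇔; Equivalence)
open import Function.Construct.Identity using (⇔-id)
open import Relation.Binary.PropositionalEquality
  using (_≡_; _≢_; _≗_; refl; sym; trans; cong; cong₂; subst; subst₂; module ≡-Reasoning)
open import Relation.Nullary using (¬_; Dec; yes; no)
open import Relation.Nullary.Decidable using (map′; ¬?; _×-dec_; _⊎-dec_; _→-dec_; decidable-stable)
open import Relation.Unary using (Decidable)

open Equivalence using (to; from)

-- Finite search

module Enumeration {A : Set} (xs : List A) (complete : ∀ x → x ∈ xs) where

  exists? : {P : A → Set} → Decidable P → Dec (∃ P)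
  exists? P? = map′ (λ p → let x , _ , px = find p in x , px)
                    (λ (x , px) → lose (complete x) px)
                    (Any.any? P? xs)

  forAll? : {P : A → Set} → Decidable P → Dec (∀ x → P x)
  forAll? P? = map′ (λ ps x → All.lookup ps (complete x))
                    (λ ps → All.tabulate (λ {x} _ → ps x))
                    (All.all? P? xs)

vectors : {A : Set} → List A → (k : ℕ) → List (Vec A k)
vectors xs zero    = [] ∷ []
vectors xs (suc k) = cartesianProductWith _∷_ xs (vectors xs k)

∈-vectors : {A : Set} {xs : List A} → (∀ x → x ∈ xs) → ∀ {k} (v : Vec A k) → v ∈ vectors xs k
∈-vectors complete []      = here refl
∈-vectors complete (x ∷ v) = ∈-cartesianProductWith⁺ _∷_ (complete x) (∈-vectors complete v)

lists : {A : Set} → List A → ℕ → List (List A)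
lists xs zero    = [] ∷ []
lists xs (suc j) = cartesianProductWith _∷_ xs (lists xs j)

map-∈-lists : {A B : Set} {xs : List B} (f : A → B) → (∀ a → f a ∈ xs) →
              ∀ ys → map f ys ∈ lists xs (length ys)
map-∈-lists f f∈ []       = here refl
map-∈-lists f f∈ (y ∷ ys) = ∈-cartesianProductWith⁺ _∷_ (f∈ y) (map-∈-lists f f∈ ys)

vertices : (n : ℕ) → List (Vertex n)
vertices = vectors (true ∷ false ∷ [])

∈-vertices : ∀ {n} (x : Vertex n) → x ∈ vertices n
∈-vertices = ∈-vectors λ { true → here refl ; false → there (here refl) }

module Vertices (n : ℕ) = Enumeration (vertices n) ∈-vertices

_≟ᵛ_ : ∀ {n} → (x y : Vertex n) → Dec (x ≡ y)
_≟ᵛ_ = Vec.≡-dec Bool._≟_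

adj? : ∀ {n} (x y : Vertex n) → Dec (Adj x y)
adj? x y = Fin.any? λ i → ¬? (lookup x i Bool.≟ lookup y i)
                     ×-dec Fin.all? (λ j → ¬? (j Fin.≟ i) →-dec (lookup x j Bool.≟ lookup y j))

-- Walks

module _ {n : ℕ} where

  WalkIn-map : {R R′ : Vertex n → Set} → (∀ {x} → R x → R′ x) →
               ∀ {u v} → WalkIn R u v → WalkIn R′ u v
  WalkIn-map f here         = here
  WalkIn-map f (step a r w) = step a (f r) (WalkIn-map f w)

  private
    _∖_ : (Vertex n → Set) → Vertex n → Vertex n → Set
    (R ∖ x) y = R y × y ≢ x

  -- Cutting a walk at its last visit to x.
  WalkIn-split : {R : Vertex n → Set} (x : Vertex n) → ∀ {u v} → WalkIn R u v →
                 WalkIn (R ∖ x) u v ⊎ WalkIn (R ∖ x) x v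
  WalkIn-split x here = inj₁ here
  WalkIn-split x (step {w = w} a r walk) with WalkIn-split x walk | w ≟ᵛ x
  ... | inj₂ walk′ | _        = inj₂ walk′
  ... | inj₁ walk′ | yes refl = inj₂ walk′
  ... | inj₁ walk′ | no w≢x   = inj₁ (step a (r , w≢x) walk′)

  WalkIn-avoid-start : {R : Vertex n → Set} → ∀ {u v} → WalkIn R u v → WalkIn (R ∖ u) u v
  WalkIn-avoid-start {u = u} walk with WalkIn-split u walk
  ... | inj₁ walk′ = walk′
  ... | inj₂ walk′ = walk′

  -- Depth-first search: the first step goes to some w ∈ U, and the rest of a
  -- walk from w never needs to return to w, so w can be deleted from U.
  walkIn-list? : (fuel : ℕ) (U : List (Vertex n)) → length U ≤ fuel → ∀ u v → Dec (WalkIn (_∈ U) u v)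
  walkIn-list? zero [] _ u v = map′ (λ { refl → here }) (λ { here → refl ; (step _ () _) }) (u ≟ᵛ v)
  walkIn-list? zero (_ ∷ _) () u v
  walkIn-list? (suc fuel) U bound u v with u ≟ᵛ v
  ... | yes refl = yes here
  ... | no u≢v   = map′ sound complete (Any.any? next? U)
    where
      _−_ : List (Vertex n) → Vertex n → List (Vertex n)
      U − w = filter (λ y → ¬? (y ≟ᵛ w)) U

      shorter : ∀ w → w ∈ U → length (U − w) ≤ fuel
      shorter w w∈U =
        ≤-pred (≤-trans (List.filter-notAll _ U (Any.map (λ w≡y y≢w → y≢w (sym w≡y)) w∈U)) bound)

      Next : Vertex n → Set
      Next w = w ∈ U → Adj u w × WalkIn (_∈ U − w) w v

      next? : Decidable Next
      next? w with ∈-dec _≟ᵛ_ w U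
      ... | yes w∈U = map′ (λ p _ → p) (λ p → p w∈U)
                           (adj? u w ×-dec walkIn-list? fuel (U − w) (shorter w w∈U) w v)
      ... | no w∉U  = yes λ w∈U → ⊥-elim (w∉U w∈U)

      sound : Any Next U → WalkIn (_∈ U) u v
      sound p with w , w∈U , next ← find p with a , walk ← next w∈U =
        step a w∈U (WalkIn-map (λ y∈ → proj₁ (∈-filter⁻ _ y∈)) walk)

      complete : WalkIn (_∈ U) u v → Any Next U
      complete here = ⊥-elim (u≢v refl)
      complete (step a w∈U walk) =
        lose w∈U λ _ → (a , WalkIn-map (λ (y∈U , y≢w) → ∈-filter⁺ _ y∈U y≢w) (WalkIn-avoid-start walk))

  walkIn? : {R : Vertex n → Set} → Decidable R → ∀ u v → Dec (WalkIn R u v)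
  walkIn? R? u v =
    map′ (WalkIn-map (λ x∈ → proj₂ (∈-filter⁻ R? {xs = vertices n} x∈)))
         (WalkIn-map (∈-filter⁺ R? (∈-vertices _)))
         (walkIn-list? (length U) U ≤-refl u v)
    where
      U : List (Vertex n)
      U = filter R? (vertices n)

-- Minimum cuts

Least : (ℕ → Set) → Set
Least P = Σ ℕ λ m → P m × (∀ {j} → P j → m ≤ j)

least : {P : ℕ → Set} → Decidable P → ∀ {b} → P b → Least P
least {P} P? = <-rec (λ b → P b → Least P) descend _
  where
    descend : ∀ b → (∀ {j} → j < b → P j → Least P) → P b → Least P
    descend b smaller pb with anyUpTo? P? b
    ... | yes (j , j<b , pj) = smaller j<b pj
    ... | no none = b , pb , λ {j} pj → ≮⇒≥ λ j<b → none (j , j<b , pj)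

Disconnected⊎Trivial-cong : ∀ {n} {R R′ : Vertex n → Set} → (∀ x → R x ⇔ R′ x) →
                            Disconnected R ⊎ Trivial R → Disconnected R′ ⊎ Trivial R′
Disconnected⊎Trivial-cong e (inj₁ (u , v , ru , rv , ¬walk)) =
  inj₁ (u , v , to (e u) ru , to (e v) rv , ¬walk ∘ WalkIn-map (from (e _)))
Disconnected⊎Trivial-cong e (inj₂ (x , rx , only)) =
  inj₂ (x , to (e x) rx , λ y ry → only y (from (e y) ry))

Visits : ∀ {n} {T : Set} → (T → Σ ℕ (PathIn n)) → T → Vertex n → Set
Visits view P x = Σ (Fin (proj₁ (view P))) λ i → vert (proj₂ (view P)) i ≡ x

module CutFamilies {n : ℕ} {T : Set} (view : T → Σ ℕ (PathIn n)) where

  covered? : ∀ F → Decidable (Covered view F)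
  covered? F x = Any.any? (λ P → Fin.any? λ i → vert (proj₂ (view P)) i ≟ᵛ x) F

  isCutFamily? : ∀ F → Dec (IsCutFamily view F)
  isCutFamily? F = disconnected? ⊎-dec trivial?
    where
      open Vertices n
      Uncovered : Vertex n → Set
      Uncovered x = ¬ Covered view F x
      uncovered? : Decidable Uncovered
      uncovered? x = ¬? (covered? F x)
      disconnected? : Dec (Disconnected Uncovered)
      disconnected? = exists? λ u → exists? λ v →
        uncovered? u ×-dec uncovered? v ×-dec ¬? (walkIn? uncovered? u v)
      trivial? : Dec (Trivial Uncovered)
      trivial? = exists? λ x → uncovered? x ×-dec forAll? λ y → uncovered? y →-dec (y ≟ᵛ x)

  isolated-cut : ∀ F x → ¬ Covered view F x → (∀ y → Adj x y → Covered view F y) → IsCutFamily view F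
  isolated-cut F x ¬cx covers with Vertices.exists? n (λ w → ¬? (w ≟ᵛ x) ×-dec ¬? (covered? F w))
  ... | yes (w , w≢x , ¬cw) =
    inj₁ (x , w , ¬cx , ¬cw , λ { here → w≢x refl ; (step x~y ¬cy _) → ¬cy (covers _ x~y) })
  ... | no none = inj₂ (x , ¬cx , λ y ¬cy → decidable-stable (y ≟ᵛ x) λ y≢x → none (y , y≢x , ¬cy))

  module _ {T′ : Set} (view′ : T′ → Σ ℕ (PathIn n)) (f : T → T′)
           (same : ∀ P {x} → Visits view P x ⇔ Visits view′ (f P) x) where

    IsCutFamily-map : ∀ F → IsCutFamily view F → IsCutFamily view′ (map f F)
    IsCutFamily-map F = Disconnected⊎Trivial-cong λ x →
      mk⇔ (λ ¬c → ¬c ∘ Any.map (from (same _)) ∘ Any.map⁻)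
          (λ ¬c → ¬c ∘ Any.map⁺ ∘ Any.map (to (same _)))

  CutOfLength : ℕ → Set
  CutOfLength j = Σ (List T) λ F → IsCutFamily view F × length F ≡ j

  IsMinimumCut : ℕ → Set
  IsMinimumCut m = CutOfLength m × (∀ F → IsCutFamily view F → m ≤ length F)

  module _ (reps : List T)
           (rep : ∀ P → Σ T λ P′ → P′ ∈ reps × (∀ {x} → Visits view P x ⇔ Visits view P′ x)) where

    cutOfLength? : ∀ j → Dec (CutOfLength j)
    cutOfLength? j =
      map′ (λ p → let F , _ , cut = find p in F , cut)
           (λ { (F , c , refl) →
                  lose (map-∈-lists rep′ (proj₁ ∘ proj₂ ∘ rep) F)
                       (IsCutFamily-map view rep′ (proj₂ ∘ proj₂ ∘ rep) F c , List.length-map rep′ F) })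
           (Any.any? (λ F → isCutFamily? F ×-dec (length F ≟ j)) (lists reps j))
      where
        rep′ : T → T
        rep′ = proj₁ ∘ rep

    minimumCut : ∀ {F} → IsCutFamily view F → Σ ℕ λ m → IsMinimumCut m × m ≤ length F
    minimumCut {F} c with m , cut , minimal ← least cutOfLength? (F , c , refl) =
      m , (cut , λ G cG → minimal (G , cG , refl)) , minimal (F , c , refl)

-- Path families up to their vertex sets

module _ {n k : ℕ} where

  IsPathVec : Vec (Vertex n) k → Set
  IsPathVec vs = (∀ i j → lookup vs i ≡ lookup vs j → i ≡ j)
               × (∀ i i′ → toℕ i′ ≡ suc (toℕ i) → Adj (lookup vs i) (lookup vs i′))

  isPathVec? : Decidable IsPathVec
  isPathVec? vs =
          Fin.all? (λ i → Fin.all? λ j → (lookup vs i ≟ᵛ lookup vs j) →-dec (i Fin.≟ j))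
    ×-dec Fin.all? (λ i → Fin.all? λ i′ →
                      (toℕ i′ ≟ suc (toℕ i)) →-dec adj? (lookup vs i) (lookup vs i′))

  pathsAmong : List (Vec (Vertex n) k) → List (PathIn n k)
  pathsAmong []         = []
  pathsAmong (vs ∷ vss) with isPathVec? vs
  ... | yes (inj , adj) = record { vert = lookup vs ; inj = inj _ _ ; adj = adj } ∷ pathsAmong vss
  ... | no _            = pathsAmong vss

  pathsAmong-complete : ∀ {vs vss} → vs ∈ vss → IsPathVec vs →
                        Σ (PathIn n k) λ P → P ∈ pathsAmong vss × vert P ≗ lookup vs
  pathsAmong-complete {vss = ws ∷ vss} vs∈ isPath with isPathVec? ws | vs∈
  ... | yes _   | here refl = _ , here refl , λ _ → refl
  ... | yes _   | there vs∈′ = let P , P∈ , same = pathsAmong-complete vs∈′ isPath in P , there P∈ , same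
  ... | no ¬ws  | here refl = ⊥-elim (¬ws isPath)
  ... | no _    | there vs∈′ = pathsAmong-complete vs∈′ isPath

paths : (n k : ℕ) → List (PathIn n k)
paths n k = pathsAmong (vectors (vertices n) k)

visits-≗ : ∀ {n k} (P Q : PathIn n k) → vert P ≗ vert Q →
           ∀ {x} → Visits structView P x ⇔ Visits structView Q x
visits-≗ _ _ P≗Q = mk⇔ (λ (i , e) → i , trans (sym (P≗Q i)) e) (λ (i , e) → i , trans (P≗Q i) e)

tabulate-isPathVec : ∀ {n k} (P : PathIn n k) → IsPathVec (tabulate (vert P))
tabulate-isPathVec P = (λ i j e → inj P (trans (sym (tab i)) (trans e (tab j))))
                     , λ i i′ e → subst₂ Adj (sym (tab i)) (sym (tab i′)) (adj P i i′ e)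
  where
    tab : ∀ i → lookup (tabulate (vert P)) i ≡ vert P i
    tab = Vec.lookup∘tabulate (vert P)

path-rep : ∀ {n k} (P : PathIn n k) →
           Σ (PathIn n k) λ P′ → P′ ∈ paths n k × (∀ {x} → Visits structView P x ⇔ Visits structView P′ x)
path-rep P
  with P′ , P′∈ , same ← pathsAmong-complete (∈-vectors {xs = vertices _} ∈-vertices (tabulate (vert P)))
                                             (tabulate-isPathVec P) =
  P′ , P′∈ , visits-≗ P P′ λ i → trans (sym (Vec.lookup∘tabulate (vert P) i)) (sym (same i))

subpaths : (n k : ℕ) → List (SubPathIn n k)
subpaths n zero    = []
subpaths n (suc k) = map (λ P → suc k , s≤s z≤n , ≤-refl , P) (paths n (suc k))
                  ++ map (λ (j , 1≤j , j≤k , P) → j , 1≤j , m≤n⇒m≤1+n j≤k , P) (subpaths n k)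

subpath-rep : ∀ {n} k (P : SubPathIn n k) →
              Σ (SubPathIn n k) λ P′ → P′ ∈ subpaths n k ×
                                       (∀ {x} → Visits subView P x ⇔ Visits subView P′ x)
subpath-rep zero    (_ , s≤s _ , () , _)
subpath-rep (suc k) (j , 1≤j , j≤k , P) with m≤n⇒m<n∨m≡n j≤k
... | inj₂ refl = let P′ , P′∈ , same = path-rep P in _ , ∈-++⁺ˡ (∈-map⁺ _ P′∈) , same
... | inj₁ j<k  = let P′ , P′∈ , same = subpath-rep k (j , 1≤j , ≤-pred j<k , P)
                 in _ , ∈-++⁺ʳ _ (∈-map⁺ _ P′∈) , same

κ-exists : ∀ {n k} {F : List (PathIn n k)} → IsStructureCut n k F →
           Σ ℕ λ m → IsKappa n k m × m ≤ length F
κ-exists {n} {k} = CutFamilies.minimumCut structView (paths n k) path-rep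

asSubPath : ∀ {n k} → 1 ≤ k → PathIn n k → SubPathIn n k
asSubPath {k = k} 1≤k P = k , 1≤k , ≤-refl , P

κˢ-exists : ∀ {n k} → 1 ≤ k → {F : List (PathIn n k)} → IsStructureCut n k F →
            Σ ℕ λ s → IsKappaS n k s × s ≤ length F
κˢ-exists {n} {k} 1≤k {F} cut
  with s , κˢ , s≤ ← CutFamilies.minimumCut subView (subpaths n k) (subpath-rep k)
                       (CutFamilies.IsCutFamily-map structView subView (asSubPath 1≤k) (λ _ → ⇔-id _) F cut) =
  s , κˢ , ≤-trans s≤ (≤-reflexive (List.length-map (asSubPath 1≤k) F))

-- Paths given by sequences of vertices

module _ {n : ℕ} where

  Adj-sym : {x y : Vertex n} → Adj x y → Adj y x
  Adj-sym (i , x≢y , rest) = i , x≢y ∘ sym , λ j j≢i → sym (rest j j≢i)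

  Adj-∷ : ∀ b {x y : Vertex n} → Adj x y → Adj (b ∷ x) (b ∷ y)
  Adj-∷ b (i , x≢y , rest) = suc i , x≢y , λ { zero _ → refl ; (suc j) j≢i → rest j (j≢i ∘ cong suc) }

  Adj-head : ∀ b (x : Vertex n) → Adj (b ∷ x) (not b ∷ x)
  Adj-head b x = zero , Bool.not-¬ refl , λ { zero 0≢0 → ⊥-elim (0≢0 refl) ; (suc j) _ → refl }

Seq : ℕ → Set
Seq n = ℕ → Vertex n

record IsPathSeq {n : ℕ} (N : ℕ) (S : Seq n) : Set where
  field
    injective : ∀ {s t} → s < N → t < N → S s ≡ S t → s ≡ t
    adjacent  : ∀ {t} → suc t < N → Adj (S t) (S (suc t))
open IsPathSeq

module _ {n : ℕ} where

  toPath : ∀ {N} {S : Seq n} → IsPathSeq N S → PathIn n N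
  toPath {N} {S} p = record
    { vert = S ∘ toℕ
    ; inj  = λ e → Fin.toℕ-injective (injective p (Fin.toℕ<n _) (Fin.toℕ<n _) e)
    ; adj  = λ i i′ i′≡1+i → subst (λ t → Adj (S (toℕ i)) (S t)) (sym i′≡1+i)
                               (adjacent p (subst (_< N) i′≡1+i (Fin.toℕ<n i′)))
    }

  singleton-path : (x : Vertex n) → IsPathSeq 1 (λ _ → x)
  singleton-path x = record { injective = λ { (s≤s z≤n) (s≤s z≤n) _ → refl } ; adjacent = λ { (s≤s ()) } }

  prefix-path : ∀ {N N′} {S : Seq n} → N′ ≤ N → IsPathSeq N S → IsPathSeq N′ S
  prefix-path N′≤N p = record
    { injective = λ s< t< → injective p (<-≤-trans s< N′≤N) (<-≤-trans t< N′≤N)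
    ; adjacent  = λ t< → adjacent p (<-≤-trans t< N′≤N)
    }

  shift-path : ∀ {s N} {S : Seq n} → IsPathSeq (s + N) S → IsPathSeq N (S ∘ (s +_))
  shift-path {s} {N} {S} p = record
    { injective = λ a< b< e → +-cancelˡ-≡ s _ _ (injective p (+-monoʳ-< s a<) (+-monoʳ-< s b<) e)
    ; adjacent  = λ {t} t< → subst (λ u → Adj (S (s + t)) (S u)) (sym (+-suc s t))
                               (adjacent p (subst (_< s + N) (+-suc s t) (+-monoʳ-< s t<)))
    }

  map-∷-path : ∀ b {N} {S : Seq n} → IsPathSeq N S → IsPathSeq N ((b ∷_) ∘ S)
  map-∷-path b p = record
    { injective = λ s< t< e → injective p s< t< (Vec.∷-injectiveʳ e)
    ; adjacent  = λ t< → Adj-∷ b (adjacent p t<)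
    }

  reverseSeq : ℕ → Seq n → Seq n
  reverseSeq N S t = S (N ∸ suc t)

  reverse-path : ∀ {N} {S : Seq n} → IsPathSeq N S → IsPathSeq N (reverseSeq N S)
  reverse-path {N} {S} p = record
    { injective = λ s< t< e → suc-injective (∸-cancelˡ-≡ s< t< (injective p (mirror s<) (mirror t<) e))
    ; adjacent  = λ {t} t< → Adj-sym {x = S (N ∸ suc (suc t))} {y = S (N ∸ suc t)}
                               (subst (λ u → Adj (S (N ∸ suc (suc t))) (S u)) (predecessor t<)
                                      (adjacent p (subst (_< N) (sym (predecessor t<)) (mirror (<⇒≤ t<)))))
    }
    where
      mirror : ∀ {t} → t < N → N ∸ suc t < N
      mirror t< = ∸-monoʳ-< (s≤s z≤n) t<
      predecessor : ∀ {t} → suc t < N → suc (N ∸ suc (suc t)) ≡ N ∸ suc t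
      predecessor t< = sym (+-∸-assoc 1 t<)

  -- Opaque, so that S ⊕⟨ a ⟩ T stays rigid for unification; it is only ever
  -- computed through ⊕-left, ⊕-right and ⊕-All.
  opaque
    _⊕⟨_⟩_ : Seq n → ℕ → Seq n → Seq n
    (S ⊕⟨ a ⟩ T) t with t <? a
    ... | yes _ = S t
    ... | no _  = T (t ∸ a)

    ⊕-left : ∀ {S T : Seq n} {a t} → t < a → (S ⊕⟨ a ⟩ T) t ≡ S t
    ⊕-left {a = a} {t} t<a with t <? a
    ... | yes _  = refl
    ... | no t≮a = ⊥-elim (t≮a t<a)

    ⊕-right : ∀ {S T : Seq n} a t → (S ⊕⟨ a ⟩ T) (a + t) ≡ T t
    ⊕-right {T = T} a t with a + t <? a
    ... | yes a+t<a = ⊥-elim (m+n≮m a t a+t<a)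
    ... | no _      = cong T (m+n∸m≡n a t)

    ⊕-All : ∀ (P : Vertex n → Set) {S T : Seq n} {a} →
            (∀ t → P (S t)) → (∀ t → P (T t)) → ∀ t → P ((S ⊕⟨ a ⟩ T) t)
    ⊕-All P {a = a} PS PT t with t <? a
    ... | yes _ = PS t
    ... | no _  = PT (t ∸ a)

  private
    split : ∀ a t → t < a ⊎ ∃ λ t′ → t ≡ a + t′
    split a t with t <? a
    ... | yes t<a = inj₁ t<a
    ... | no t≮a  = inj₂ (t ∸ a , sym (m+[n∸m]≡n (≮⇒≥ t≮a)))

  ⊕-path : ∀ {a b} {S T : Seq n} → IsPathSeq a S → IsPathSeq b T →
           Adj (S (a ∸ 1)) (T 0) → (∀ {s t} → s < a → t < b → S s ≢ T t) →
           IsPathSeq (a + b) (S ⊕⟨ a ⟩ T)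
  ⊕-path {a} {b} {S} {T} pS pT junction disjoint = record { injective = inj′ ; adjacent = adj′ }
    where
      U : Seq n
      U = S ⊕⟨ a ⟩ T

      inj′ : ∀ {s t} → s < a + b → t < a + b → U s ≡ U t → s ≡ t
      inj′ {s} {t} s< t< e with split a s | split a t
      ... | inj₁ s<a | inj₁ t<a = injective pS s<a t<a (trans (sym (⊕-left s<a)) (trans e (⊕-left t<a)))
      ... | inj₁ s<a | inj₂ (t′ , refl) =
        ⊥-elim (disjoint s<a (+-cancelˡ-< a t′ b t<) (trans (sym (⊕-left s<a)) (trans e (⊕-right a t′))))
      ... | inj₂ (s′ , refl) | inj₁ t<a =
        ⊥-elim (disjoint t<a (+-cancelˡ-< a s′ b s<) (trans (sym (⊕-left t<a)) (trans (sym e) (⊕-right a s′))))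
      ... | inj₂ (s′ , refl) | inj₂ (t′ , refl) =
        cong (a +_) (injective pT (+-cancelˡ-< a s′ b s<) (+-cancelˡ-< a t′ b t<)
                       (trans (sym (⊕-right a s′)) (trans e (⊕-right a t′))))

      adj′ : ∀ {t} → suc t < a + b → Adj (U t) (U (suc t))
      adj′ {t} st< with split a (suc t)
      ... | inj₁ st<a = subst₂ Adj (sym (⊕-left (<⇒≤ st<a))) (sym (⊕-left st<a)) (adjacent pS st<a)
      ... | inj₂ (zero , e) =
        subst₂ Adj (sym (trans (⊕-left t<a) (cong S t≡a∸1))) (sym (trans (cong U e) (⊕-right a 0))) junction
        where
          a≡1+t : a ≡ suc t
          a≡1+t = trans (sym (+-identityʳ a)) (sym e)
          t<a : t < a
          t<a = ≤-reflexive (sym a≡1+t)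
          t≡a∸1 : t ≡ a ∸ 1
          t≡a∸1 = cong (_∸ 1) (sym a≡1+t)
      ... | inj₂ (suc t′ , e) with refl ← suc-injective (trans e (+-suc a t′)) =
        subst₂ Adj (sym (⊕-right a t′)) (sym (trans (cong U e) (⊕-right a (suc t′))))
               (adjacent pT (+-cancelˡ-< a (suc t′) b (subst (_< a + b) e st<)))

  _◁_ : Vertex n → Seq n → Seq n
  x ◁ S = (λ _ → x) ⊕⟨ 1 ⟩ S

  ◁-head : ∀ {x} {S : Seq n} → (x ◁ S) 0 ≡ x
  ◁-head = ⊕-left (s≤s z≤n)

  ◁-tail : ∀ {x} {S : Seq n} t → (x ◁ S) (suc t) ≡ S t
  ◁-tail = ⊕-right 1

  ◁-path : ∀ {N} {x} {S : Seq n} → IsPathSeq N S → Adj x (S 0) → (∀ {t} → t < N → x ≢ S t) →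
           IsPathSeq (suc N) (x ◁ S)
  ◁-path p x~S0 x∉S = ⊕-path (singleton-path _) p x~S0 λ { (s≤s z≤n) → x∉S }

-- The snake

zeros : ∀ {n} → Vertex n
zeros = replicate _ false

unit : ∀ {n} → Fin n → Vertex n
unit zero    = true ∷ zeros
unit (suc i) = false ∷ unit i

Adj-zeros⇒unit : ∀ {n} {y : Vertex n} → Adj zeros y → ∃ λ i → y ≡ unit i
Adj-zeros⇒unit {y = true ∷ y} (zero , _ , rest) =
  zero , cong (true ∷_) (begin
    y                       ≡⟨ Vec.tabulate∘lookup y ⟨
    tabulate (lookup y)     ≡⟨ Vec.tabulate-cong (λ j → rest (suc j) λ ()) ⟨
    tabulate (lookup zeros) ≡⟨ Vec.tabulate∘lookup zeros ⟩
    zeros                   ∎)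
  where open ≡-Reasoning
Adj-zeros⇒unit {y = false ∷ y} (zero , f≢f , _) = ⊥-elim (f≢f refl)
Adj-zeros⇒unit {y = b ∷ y} (suc i , ne , rest)
  with j , y≡ ← Adj-zeros⇒unit {y = y} (i , ne , λ j j≢i → rest (suc j) (j≢i ∘ Fin.suc-injective)) =
  suc j , cong₂ _∷_ (sym (rest zero λ ())) y≡

gray : (m : ℕ) → Seq m
gray zero    = λ _ → []
gray (suc m) = ((false ∷_) ∘ gray m) ⊕⟨ 2 ^ m ⟩ ((true ∷_) ∘ reverseSeq (2 ^ m) (gray m))

2^[1+m]≡2^m+2^m : ∀ m → 2 ^ suc m ≡ 2 ^ m + 2 ^ m
2^[1+m]≡2^m+2^m m = cong (2 ^ m +_) (+-identityʳ (2 ^ m))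

gray-path : ∀ m → IsPathSeq (2 ^ m) (gray m)
gray-path zero    = singleton-path []
gray-path (suc m) = subst (λ N → IsPathSeq N (gray (suc m))) (sym (2^[1+m]≡2^m+2^m m))
  (⊕-path (map-∷-path false (gray-path m)) (map-∷-path true (reverse-path (gray-path m)))
          (Adj-head false _) λ _ _ ())

gray-zero : ∀ m → gray m 0 ≡ zeros
gray-zero zero    = refl
gray-zero (suc m) = trans (⊕-left (m^n>0 2 m)) (cong (false ∷_) (gray-zero m))

gray-last : ∀ m → gray (suc m) (2 ^ suc m ∸ 1) ≡ unit zero
gray-last m = begin
  gray (suc m) (2 ^ suc m ∸ 1)             ≡⟨ cong (λ t → gray (suc m) (t ∸ 1)) (2^[1+m]≡2^m+2^m m) ⟩
  gray (suc m) (2 ^ m + 2 ^ m ∸ 1)         ≡⟨ cong (gray (suc m)) (+-∸-assoc (2 ^ m) 1≤2^m) ⟩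
  gray (suc m) (2 ^ m + (2 ^ m ∸ 1))       ≡⟨ ⊕-right (2 ^ m) _ ⟩
  true ∷ gray m (2 ^ m ∸ suc (2 ^ m ∸ 1))  ≡⟨ cong (λ t → true ∷ gray m (2 ^ m ∸ t)) (m+[n∸m]≡n 1≤2^m) ⟩
  true ∷ gray m (2 ^ m ∸ 2 ^ m)            ≡⟨ cong (λ t → true ∷ gray m t) (n∸n≡0 (2 ^ m)) ⟩
  true ∷ gray m 0                          ≡⟨ cong (true ∷_) (gray-zero m) ⟩
  unit zero                                ∎
  where
    open ≡-Reasoning
    1≤2^m : 1 ≤ 2 ^ m
    1≤2^m = m^n>0 2 m

snake : (m : ℕ) → Seq (suc m)
snake zero    = λ _ → unit zero
snake (suc m) = ((false ∷_) ∘ snake m) ⊕⟨ suc (2 * m) ⟩ ((true ∷_) ∘ (unit zero ◁ gray (suc m)))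

2*[1+m]≡[1+2m]+1 : ∀ m → 2 * suc m ≡ suc (2 * m) + 1
2*[1+m]≡[1+2m]+1 = solve-∀

1+2*[1+m]≡[1+2m]+2 : ∀ m → suc (2 * suc m) ≡ suc (2 * m) + 2
1+2*[1+m]≡[1+2m]+2 = solve-∀

snake[2m]≡unit-zero : ∀ m → snake m (2 * m) ≡ unit zero
snake[2m]≡unit-zero zero    = refl
snake[2m]≡unit-zero (suc m) = begin
  snake (suc m) (2 * suc m)           ≡⟨ cong (snake (suc m)) (2*[1+m]≡[1+2m]+1 m) ⟩
  snake (suc m) (suc (2 * m) + 1)     ≡⟨ ⊕-right (suc (2 * m)) 1 ⟩
  true ∷ (unit zero ◁ gray (suc m)) 1 ≡⟨ cong (true ∷_) (◁-tail 0) ⟩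
  true ∷ gray (suc m) 0               ≡⟨ cong (true ∷_) (gray-zero (suc m)) ⟩
  unit zero                           ∎
  where open ≡-Reasoning

snake-units : ∀ m (i : Fin (suc m)) → ∃ λ j → j ≤ m × snake m (2 * j) ≡ unit i
snake-units m       zero    = m , ≤-refl , snake[2m]≡unit-zero m
snake-units (suc m) (suc i) with j , j≤m , e ← snake-units m i =
  j , m≤n⇒m≤1+n j≤m , trans (⊕-left (s≤s (*-monoʳ-≤ 2 j≤m))) (cong (false ∷_) e)

snake-nonzero : ∀ m t → snake m t ≢ zeros
snake-nonzero zero    t ()
snake-nonzero (suc m) = ⊕-All (_≢ zeros) (λ t → snake-nonzero m t ∘ Vec.∷-injectiveʳ) λ _ ()

snakeLength : ℕ → ℕ
snakeLength m = suc (2 * m) + 2 ^ suc m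

1+2[1+m]≤snakeLength : ∀ m → suc (2 * suc m) ≤ snakeLength m
1+2[1+m]≤snakeLength m =
  ≤-trans (≤-reflexive (1+2*[1+m]≡[1+2m]+2 m)) (+-monoʳ-≤ (suc (2 * m)) (^-monoʳ-≤ 2 {1} {suc m} (s≤s z≤n)))

staircase-path : ∀ m → IsPathSeq (suc (2 * m)) (snake m)
snake-path : ∀ m → IsPathSeq (snakeLength m) (snake (suc m))

staircase-path zero    = singleton-path _
staircase-path (suc m) = prefix-path (1+2[1+m]≤snakeLength m) (snake-path m)

snake-path m =
  ⊕-path (map-∷-path false (staircase-path m)) (map-∷-path true tail-path)
         (subst₂ (λ x y → Adj (false ∷ x) (true ∷ y)) (sym (snake[2m]≡unit-zero m)) (sym ◁-head)
                 (Adj-head false (unit zero)))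
         λ _ _ ()
  where
    N : ℕ
    N = 2 ^ suc m ∸ 1
    1≤2^ : 1 ≤ 2 ^ suc m
    1≤2^ = m^n>0 2 (suc m)
    N<2^ : N < 2 ^ suc m
    N<2^ = ∸-monoʳ-< (s≤s z≤n) 1≤2^
    tail-path : IsPathSeq (2 ^ suc m) (unit zero ◁ gray (suc m))
    tail-path = subst (λ L → IsPathSeq L (unit zero ◁ gray (suc m))) (m+[n∸m]≡n 1≤2^)
      (◁-path (prefix-path (m∸n≤m _ 1) (gray-path (suc m)))
              (subst (Adj (unit zero)) (sym (gray-zero (suc m))) (Adj-head true zeros))
              λ {t} t<N e → <⇒≢ t<N (injective (gray-path (suc m)) (<-≤-trans t<N (m∸n≤m _ 1)) N<2^
                                                 (trans (sym e) (sym (gray-last m)))))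

-- Windows of the snake

-- ⌈ k / 2 ⌉ = suc h
Halves : ℕ → ℕ → Set
Halves k h = k ≡ suc (h * 2) ⊎ k ≡ suc (suc (h * 2))

halves : ∀ k → 1 ≤ k → ∃ (Halves k)
halves 1 _ = 0 , inj₁ refl
halves 2 _ = 0 , inj₂ refl
halves (suc (suc (suc k))) _ with h , e ← halves (suc k) (s≤s z≤n) =
  suc h , Sum.map (cong (2 +_)) (cong (2 +_)) e

bound-odd : ∀ n k → k % 2 ≡ 1 → bound n k ≡ ceilDivSuc (2 * n) k
bound-odd n k k%2≡1 with k % 2
... | 1 = refl
... | 0 = ⊥-elim (0≢1+n k%2≡1)
... | suc (suc _) = ⊥-elim (1+n≢0 (suc-injective k%2≡1))

bound-even : ∀ n k → k % 2 ≡ 0 → bound n k ≡ ceilDivSuc (2 * n) (k ∸ 1)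
bound-even n k k%2≡0 with k % 2
... | 0 = refl
... | 1 = ⊥-elim (1+n≢0 k%2≡0)
... | suc (suc _) = refl

bound-halves : ∀ n {k} h → Halves k h → bound n k ≡ ceilDivSuc (2 * n) (suc (h * 2))
bound-halves n h (inj₁ refl) = bound-odd n (suc (h * 2)) ([m+kn]%n≡m%n 1 h 2)
bound-halves n h (inj₂ refl) = bound-even n (suc (suc (h * 2))) ([m+kn]%n≡m%n 2 h 2)

index<bound : ∀ n {k} h → Halves k h → ∀ {j} → j < n → j / suc h < bound n k
index<bound n h k≡ {j} j<n rewrite bound-halves n h k≡ =
  ≤-trans (≤-reflexive (sym (m*n/n≡m (suc q) d))) (/-monoˡ-≤ d product≤)
  where
    q d : ℕ
    q = j / suc h
    d = suc (suc (h * 2))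
    product≤ : suc q * d ≤ 2 * n + suc (h * 2)
    product≤ = begin
      suc q * d                   ≡⟨ lemma₁ q h ⟩
      2 * (q * suc h) + 2 * suc h ≤⟨ +-monoˡ-≤ (2 * suc h) (*-monoʳ-≤ 2 (m/n*n≤m j (suc h))) ⟩
      2 * j + 2 * suc h           ≡⟨ lemma₂ j h ⟩
      2 * suc j + h * 2           ≤⟨ +-monoˡ-≤ (h * 2) (*-monoʳ-≤ 2 j<n) ⟩
      2 * n + h * 2               ≤⟨ +-monoʳ-≤ (2 * n) (n≤1+n (h * 2)) ⟩
      2 * n + suc (h * 2)         ∎
      where
        open ≤-Reasoning
        lemma₁ : ∀ q h → suc q * suc (suc (h * 2)) ≡ 2 * (q * suc h) + 2 * suc h
        lemma₁ = solve-∀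
        lemma₂ : ∀ j h → 2 * j + 2 * suc h ≡ 2 * suc j + h * 2
        lemma₂ = solve-∀

double<halves : ∀ {k} h → Halves k h → ∀ {x} → x ≤ h → 2 * x < k
double<halves {k} h k≡ {x} x≤h =
  ≤-trans (s≤s (≤-trans (*-monoʳ-≤ 2 x≤h) (≤-reflexive (*-comm 2 h)))) (1+h*2≤ k≡)
  where
    1+h*2≤ : Halves k h → suc (h * 2) ≤ k
    1+h*2≤ (inj₁ refl) = ≤-refl
    1+h*2≤ (inj₂ refl) = n≤1+n _

module _ {m k : ℕ} where

  window : ∀ s → s + k ≤ snakeLength m → PathIn (suc (suc m)) k
  window s fits = toPath (shift-path {s = s} (prefix-path fits (snake-path m)))

  window-visits : ∀ {s p} (fits : s + k ≤ snakeLength m) → s ≤ p → p < s + k →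
                  Visits structView (window s fits) (snake (suc m) p)
  window-visits {s} {p} fits s≤p p<s+k =
    fromℕ< (subst (p ∸ s <_) (m+n∸m≡n s k) (∸-monoˡ-< p<s+k s≤p))
    , cong (snake (suc m)) (trans (cong (s +_) (Fin.toℕ-fromℕ< _)) (m+[n∸m]≡n s≤p))

  window-nonzero : ∀ {s} (fits : s + k ≤ snakeLength m) → ¬ Visits structView (window s fits) zeros
  window-nonzero fits (i , e) = snake-nonzero (suc m) _ e

module WindowFamily (m k h : ℕ) (k≡ : Halves k h) (k≤N : k ≤ snakeLength m) where

  start : ℕ → ℕ
  start q = (2 * (q * suc h)) ⊓ (snakeLength m ∸ k)

  fits : ∀ q → start q + k ≤ snakeLength m
  fits q = ≤-trans (+-monoˡ-≤ k (m⊓n≤n _ _)) (≤-reflexive (m∸n+n≡m k≤N))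

  family : List (PathIn (suc (suc m)) k)
  family = map (λ q → window (start q) (fits q)) (upTo (bound (suc (suc m)) k))

  family-length : length family ≡ bound (suc (suc m)) k
  family-length = trans (List.length-map (λ q → window (start q) (fits q)) (upTo B)) (List.length-upTo B)
    where
      B : ℕ
      B = bound (suc (suc m)) k

  family-avoids-zeros : ¬ Covered structView family zeros
  family-avoids-zeros c with q , _ , visits ← find (Any.map⁻ c) = window-nonzero (fits q) visits

  -- The unit at position 2 j of the snake lies in the window of index ⌊ j / ⌈k/2⌉ ⌋.
  family-covers-units : ∀ i → Covered structView family (unit i)
  family-covers-units i with j , j≤m+1 , e ← snake-units (suc m) i =
    subst (Covered structView family) e
      (Any.map⁺ (lose (∈-upTo⁺ (index<bound (suc (suc m)) h k≡ (s≤s j≤m+1)))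
                      (window-visits (fits q) start≤2j 2j<start+k)))
    where
      q : ℕ
      q = j / suc h
      start≤2j : start q ≤ 2 * j
      start≤2j = ≤-trans (m⊓n≤m _ _) (*-monoʳ-≤ 2 (m/n*n≤m j (suc h)))
      below-window : 2 * j < 2 * (q * suc h) + k
      below-window = begin-strict
        2 * j                             ≡⟨ cong (2 *_) (m≡m%n+[m/n]*n j (suc h)) ⟩
        2 * (j % suc h + q * suc h)       ≡⟨ *-distribˡ-+ 2 (j % suc h) (q * suc h) ⟩
        2 * (j % suc h) + 2 * (q * suc h) <⟨ +-monoˡ-< _ (double<halves h k≡ (≤-pred (m%n<n j (suc h)))) ⟩
        k + 2 * (q * suc h)               ≡⟨ +-comm k _ ⟩
        2 * (q * suc h) + k               ∎
        where open ≤-Reasoning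
      2j<start+k : 2 * j < start q + k
      2j<start+k = subst (2 * j <_) (sym (+-distribʳ-⊓ k (2 * (q * suc h)) _))
        (⊓-glb below-window (subst (2 * j <_) (sym (m∸n+n≡m k≤N))
                                    (<-≤-trans (s≤s (*-monoʳ-≤ 2 j≤m+1)) (1+2[1+m]≤snakeLength m))))

  family-covers-neighbours : ∀ y → Adj zeros y → Covered structView family y
  family-covers-neighbours y 0~y with i , refl ← Adj-zeros⇒unit {y = y} 0~y = family-covers-units i

structure-cut : ∀ m k → 1 ≤ k → k ≤ 2 ^ suc m →
                Σ (List (PathIn (suc (suc m)) k)) λ F →
                  IsStructureCut (suc (suc m)) k F × length F ≤ bound (suc (suc m)) k
structure-cut m k 1≤k k≤2^ with h , k≡ ← halves k 1≤k =
    family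
  , CutFamilies.isolated-cut structView family zeros family-avoids-zeros family-covers-neighbours
  , ≤-reflexive family-length
  where
    open WindowFamily m k h k≡ (≤-trans k≤2^ (m≤n+m (2 ^ suc m) (suc (2 * m))))

lemma10 : (n k : ℕ) → 3 ≤ n → 3 ≤ k → k ≤ 2 ^ (n ∸ 1) →
    Σ ℕ λ s → Σ ℕ λ m → IsKappaS n k s × IsKappa n k m × s ≤ m × m ≤ bound n k
lemma10 (suc (suc m)) k (s≤s (s≤s _)) (s≤s _) k≤2^
  with F , cut , F≤bound ← structure-cut m k (s≤s z≤n) k≤2^
  with κ , κ-min@((G , cutG , refl) , _) , κ≤F ← κ-exists cut
  with s , κˢ-min , κˢ≤G ← κˢ-exists (s≤s z≤n) cutG =
  s , κ , κˢ-min , κ-min , κˢ≤G , ≤-trans κ≤F F≤bound
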